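{- Fix an integer $y \ge 1$. The binary relation $P(x, C) \equiv [(2^x - 3^y) \mid C]$ on $\mathbb{N}^2$ (divisibility taken in $\mathbb{Z}$) is not definable in Presburger arithmetic.
   Context: Presburger arithmetic is the first-order theory of $(\mathbb{N}, +, <, 0, 1)$; a relation is definable in it if it is the set of tuples satisfying some first-order formula in this language. -}

module Defs where

open import Data.Nat using (ℕ; suc) renaming (_+_ to _+ℕ_; _<_ to _<ℕ_)
open import Data.Fin using (Fin)
open import Data.Vec using (Vec; _∷_; []; lookup)
open import Data.Product using (_×_; Σ; ∃)
open import Data.Sum using (_⊎_)
open import Relation.Nullary using (¬_)
open import Relation.Binary.PropositionalEquality using (_≡_)
open import Function.Bundles using (_⇔_)

data Term (n : ℕ) : Set where
  var  : Fin n → Term n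
  `0   : Term n
  `1   : Term n
  _⊕_  : Term n → Term n → Term n

data Formula (n : ℕ) : Set where
  _≐_  : Term n → Term n → Formula n
  _≺_  : Term n → Term n → Formula n
  ¬'_  : Formula n → Formula n
  _∧'_ : Formula n → Formula n → Formula n
  _∨'_ : Formula n → Formula n → Formula n
  _⇒'_ : Formula n → Formula n → Formula n
  ∃'   : Formula (suc n) → Formula n
  ∀'   : Formula (suc n) → Formula n

evalT : ∀ {n} → Term n → Vec ℕ n → ℕ
evalT (var i) ρ = lookup ρ i
evalT `0 ρ = 0
evalT `1 ρ = 1
evalT (s ⊕ t) ρ = evalT s ρ +ℕ evalT t ρ

⟦_⟧ : ∀ {n} → Formula n → Vec ℕ n → Set
⟦ s ≐ t ⟧ ρ = evalT s ρ ≡ evalT t ρ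
⟦ s ≺ t ⟧ ρ = evalT s ρ <ℕ evalT t ρ
⟦ ¬' φ ⟧ ρ = ¬ ⟦ φ ⟧ ρ
⟦ φ ∧' ψ ⟧ ρ = ⟦ φ ⟧ ρ × ⟦ ψ ⟧ ρ
⟦ φ ∨' ψ ⟧ ρ = ⟦ φ ⟧ ρ ⊎ ⟦ ψ ⟧ ρ
⟦ φ ⇒' ψ ⟧ ρ = ⟦ φ ⟧ ρ → ⟦ ψ ⟧ ρ
⟦ ∃' φ ⟧ ρ = ∃ λ a → ⟦ φ ⟧ (a ∷ ρ)
⟦ ∀' φ ⟧ ρ = (a : ℕ) → ⟦ φ ⟧ (a ∷ ρ)

PresburgerDefinable₂ : (ℕ → ℕ → Set) → Set
PresburgerDefinable₂ R =
  Σ (Formula 2) λ φ → (x c : ℕ) → ⟦ φ ⟧ (x ∷ c ∷ []) ⇔ R x c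

{-# OPTIONS --safe #-}
-- By Cooper's quantifier elimination, a Presburger formula is equivalent to a boolean
-- combination of atoms 0 < L and (1 + m) ∣ L with L linear.  In a combination χ(x, C), an
-- atom 0 < e + a x + b C with b ≠ 0 has constant truth value once C > (|a| + |e|)(x + 1),
-- and the divisibility atoms are periodic in C with period M, the product of their moduli.
-- So a definable relation satisfies R x C ⇔ R x (C + M) whenever C > B (x + 1) for some B.
-- For d = 2^x − 3^y this fails as soon as d > B (x + 1) + M: d divides d M but not d M + M.
module Submission where

open import Defs
open import Data.Nat using (ℕ; _≥_; _^_)
open import Data.Integer using (+_; _-_)
open import Data.Integer.Divisibility using (_∣_)
open import Relation.Nullary using (¬_)

open import Data.Nat as ℕ using (zero; suc; NonZero; _∸_)
import Data.Nat.Properties as ℕ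
import Data.Nat.Divisibility as ℕ
import Data.Nat.Tactic.RingSolver as ℕ-Solver
open import Data.Nat.Induction using (<-wellFounded)
open import Data.Nat.ListAction using (sum; product)
open import Data.Nat.ListAction.Properties using (∈⇒∣product; product≢0)
open import Data.Integer as ℤ using (ℤ; -[1+_]; 0ℤ; 1ℤ; -1ℤ; _+_; _*_; -_; ∣_∣; _<_; _≤_)
import Data.Integer.Properties as ℤ
import Data.Integer.Divisibility as ℤ
import Data.Integer.Divisibility.Signed as Signed
open import Data.Integer.Tactic.RingSolver using (solve-∀)
open import Data.Fin using (Fin; zero; suc)
open import Data.Vec as Vec using (Vec; []; _∷_; lookup; _[_]≔_)
open import Data.List as List using (List; []; _∷_; _++_; upTo)
open import Data.List.Membership.Propositional using (_∈_; lose)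
open import Data.List.Membership.Propositional.Properties using (∈-++⁺ˡ; ∈-++⁺ʳ; ∈-map⁺)
open import Data.List.Relation.Unary.Any as Any using (Any; here; there; any?; satisfied)
import Data.List.Relation.Unary.Any.Properties as Any
import Data.List.Relation.Unary.All as All
import Data.List.Relation.Unary.All.Properties as All
open import Data.Empty using (⊥; ⊥-elim)
open import Data.Product using (_×_; _,_; proj₁; proj₂; ∃)
open import Data.Product.Function.NonDependent.Propositional using (_×-⇔_)
open import Data.Sum using (_⊎_; inj₁; inj₂; [_,_])
open import Data.Sum.Function.Propositional using (_⊎-⇔_)
open import Function.Base using (_∘_; id)
open import Function.Bundles using (_⇔_; mk⇔; Equivalence)
open Equivalence using (to; from)
open import Function.Construct.Composition using (_⇔-∘_)
open import Function.Construct.Identity using (⇔-id)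
open import Function.Construct.Symmetry using (⇔-sym)
open import Function.Related.TypeIsomorphisms using (¬-cong-⇔; →-cong-⇔)
open import Induction.WellFounded using (Acc; acc)
open import Relation.Nullary using (Dec; yes; no; ¬?)
open import Relation.Nullary.Decidable using (_×-dec_; _⊎-dec_; decidable-stable)
open import Relation.Unary using (Decidable)
open import Relation.Binary.PropositionalEquality
  using (_≡_; refl; sym; trans; cong; cong₂; subst; subst₂; module ≡-Reasoning)

both : {A B : Set} → A → B → A ⇔ B
both a b = mk⇔ (λ _ → b) (λ _ → a)

neither : {A B : Set} → ¬ A → ¬ B → A ⇔ B
neither ¬a ¬b = mk⇔ (⊥-elim ∘ ¬a) (⊥-elim ∘ ¬b)

→⇔¬⊎ : {A B : Set} → Dec A → (A → B) ⇔ (¬ A ⊎ B)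
→⇔¬⊎ {A} {B} a? = mk⇔ (decide a?) [ (λ ¬a a → ⊥-elim (¬a a)) , (λ b _ → b) ]
  where
  decide : Dec A → (A → B) → ¬ A ⊎ B
  decide (yes a) f = inj₂ (f a)
  decide (no ¬a) _ = inj₁ ¬a

Π⇔¬∃¬ : {A : Set} {P : A → Set} → (∀ a → Dec (P a)) → (∀ a → P a) ⇔ (¬ ∃ λ a → ¬ P a)
Π⇔¬∃¬ P? = mk⇔ (λ ∀P (a , ¬Pa) → ¬Pa (∀P a))
               (λ ¬∃¬ a → decidable-stable (P? a) (λ ¬Pa → ¬∃¬ (a , ¬Pa)))

Π-cong-⇔ : {A : Set} {P Q : A → Set} → (∀ a → P a ⇔ Q a) → (∀ a → P a) ⇔ (∀ a → Q a)
Π-cong-⇔ P⇔Q = mk⇔ (λ ∀P a → to (P⇔Q a) (∀P a)) (λ ∀Q a → from (P⇔Q a) (∀Q a))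

∃-cong-⇔ : {A : Set} {P Q : A → Set} → (∀ a → P a ⇔ Q a) → (∃ λ a → P a) ⇔ (∃ λ a → Q a)
∃-cong-⇔ P⇔Q = mk⇔ (λ (a , Pa) → a , to (P⇔Q a) Pa) (λ (a , Qa) → a , from (P⇔Q a) Qa)

≡⇔≮×≯ : ∀ m n → m ≡ n ⇔ (¬ m ℕ.< n × ¬ n ℕ.< m)
≡⇔≮×≯ m n = mk⇔ (λ { refl → ℕ.<-irrefl refl , ℕ.<-irrefl refl })
                (λ (m≮n , n≮m) → ℕ.≤∧≮⇒≡ (ℕ.≮⇒≥ n≮m) m≮n)

∈⇒≤sum : ∀ {n ns} → n ∈ ns → n ℕ.≤ sum ns
∈⇒≤sum {ns = m ∷ ms} (here refl) = ℕ.m≤m+n m (sum ms)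
∈⇒≤sum {ns = m ∷ ms} (there n∈)  = ℕ.≤-trans (∈⇒≤sum n∈) (ℕ.m≤n+m (sum ms) m)

<⇔0<- : ∀ m n → m ℕ.< n ⇔ 0ℤ < + n - + m
<⇔0<- m n = mk⇔
  (λ m<n → subst₂ _<_ (ℤ.n⊖n≡0 m) (sym n-m≡n⊖m) (ℤ.⊖-monoˡ-< m m<n))
  (λ 0<n-m → ℕ.≰⇒> λ n≤m → ℤ.<⇒≱ 0<n-m (subst₂ _≤_ (sym n-m≡n⊖m) (ℤ.n⊖n≡0 m) (ℤ.⊖-monoˡ-≤ m n≤m)))
  where n-m≡n⊖m = ℤ.[+m]-[+n]≡m⊖n n m

0<-⇔<0 : ∀ w → 0ℤ < - w ⇔ w < 0ℤ
0<-⇔<0 w = mk⇔ ℤ.neg-cancel-< ℤ.neg-mono-<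

0<-*-pos : ∀ c z → 0ℤ < + suc c * z ⇔ 0ℤ < z
0<-*-pos c z = mk⇔
  (λ 0<cz → ℤ.*-cancelˡ-<-nonNeg (+ suc c) (subst (_< + suc c * z) (sym (ℤ.*-zeroʳ (+ suc c))) 0<cz))
  (λ 0<z → subst (_< + suc c * z) (ℤ.*-zeroʳ (+ suc c)) (ℤ.*-monoˡ-<-pos (+ suc c) 0<z))

∣-*-pos : ∀ c m z → (+ suc c * + suc m ∣ + suc c * z) ⇔ (+ suc m ∣ z)
∣-*-pos c m z = mk⇔ (ℤ.*-cancelˡ-∣ (+ suc c) {+ suc m} {z}) (ℤ.*-monoʳ-∣ (+ suc c) {+ suc m} {z})

∣m+n⇔∣m : ∀ {k m n} → k ∣ n → (k ∣ m + n) ⇔ (k ∣ m)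
∣m+n⇔∣m {k} {m} {n} k∣n = mk⇔
  (λ k∣m+n → Signed.∣⇒∣ᵤ (Signed.∣m+n∣n⇒∣m {k} {m} {n} (Signed.∣ᵤ⇒∣ k∣m+n) k∣ₛn))
  (λ k∣m → Signed.∣⇒∣ᵤ (Signed.∣m∣n⇒∣m+n {k} {m} {n} (Signed.∣ᵤ⇒∣ k∣m) k∣ₛn))
  where k∣ₛn = Signed.∣ᵤ⇒∣ k∣n

∣i∣<n⇒0<i+n : ∀ i {n} → ∣ i ∣ ℕ.< n → 0ℤ < i + + n
∣i∣<n⇒0<i+n (+ m)    {n} m<n = ℤ.+<+ (ℕ.<-≤-trans (ℕ.≤-<-trans ℕ.z≤n m<n) (ℕ.m≤n+m n m))
∣i∣<n⇒0<i+n -[1+ m ] {n} m<n =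
  subst (0ℤ <_) (sym (ℤ.⊖-≥ (ℕ.<⇒≤ m<n))) (ℤ.+<+ (ℕ.m<n⇒0<n∸m m<n))

∣u∣<C⇒0<u+[1+q]C : ∀ u q {C} → ∣ u ∣ ℕ.< C → 0ℤ < u + + suc q * + C
∣u∣<C⇒0<u+[1+q]C u q {C} ∣u∣<C = subst (λ v → 0ℤ < u + v) (ℤ.pos-* (suc q) C)
  (∣i∣<n⇒0<i+n u (ℕ.<-≤-trans ∣u∣<C (ℕ.m≤m+n C (q ℕ.* C))))

∣u∣<C⇒0≮u-[1+q]C : ∀ u q {C} → ∣ u ∣ ℕ.< C → ¬ 0ℤ < u + -[1+ q ] * + C
∣u∣<C⇒0≮u-[1+q]C u q {C} ∣u∣<C = ℤ.<-asym (subst (_< 0ℤ) (sym (flip-sign u (+ suc q) (+ C)))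
  (ℤ.neg-mono-< (∣u∣<C⇒0<u+[1+q]C (- u) q ∣-u∣<C)))
  where
  ∣-u∣<C = subst (ℕ._< C) (sym (ℤ.∣-i∣≡∣i∣ u)) ∣u∣<C
  flip-sign : ∀ u c x → u + - c * x ≡ - (- u + c * x)
  flip-sign = solve-∀

∣[+m]-[+n]∣ : ∀ {m n} → n ℕ.≤ m → ∣ + m - + n ∣ ≡ m ∸ n
∣[+m]-[+n]∣ {m} {n} n≤m = cong ∣_∣ (trans (ℤ.[+m]-[+n]≡m⊖n m n) (ℤ.⊖-≥ n≤m))

sign-stable : ∀ w E → ¬ (0ℤ ≤ w + + E × w + + E ≤ + E) →
              (0ℤ < w + + E ⇔ 0ℤ < w) × (w + + E < 0ℤ ⇔ w < 0ℤ)
sign-stable w E ∉ with 0ℤ ℤ.≤? w + + E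
... | no 0≰v = neither (0≰v ∘ ℤ.<⇒≤) (ℤ.<-asym w<0) , both v<0 w<0
  where
  v<0 = ℤ.≰⇒> 0≰v
  w<0 = ℤ.≤-<-trans (ℤ.i≤i+j w (+ E)) v<0
... | yes 0≤v = both 0<v 0<w , neither (ℤ.<-asym 0<v) (ℤ.<-asym 0<w)
  where
  E<v = ℤ.≰⇒> (λ v≤E → ∉ (0≤v , v≤E))
  0<v = ℤ.≤-<-trans (ℤ.+≤+ ℕ.z≤n) E<v
  0<w = ℤ.≰⇒> (λ w≤0 → ℤ.<⇒≱ E<v (ℤ.+-monoˡ-≤ (+ E) w≤0))

n<2^n : ∀ n → n ℕ.< 2 ^ n
n<2^n zero    = ℕ.z<s
n<2^n (suc n) = begin-strict
  suc n             ≤⟨ n<2^n n ⟩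
  2 ^ n             <⟨ ℕ.m<m+n (2 ^ n) (ℕ.m^n>0 2 n) ⟩
  2 ^ n ℕ.+ 2 ^ n   ≡⟨ cong (ℕ._+_ (2 ^ n)) (ℕ.+-identityʳ (2 ^ n)) ⟨
  2 ^ suc n         ∎
  where open ℕ.≤-Reasoning

-- Take x = 2m with m = 2K + 1: then K (x + 1) < (m + 1)² ≤ 2^m 2^m.
linear<exponential : ∀ K → ∃ λ x → K ℕ.* suc x ℕ.< 2 ^ x
linear<exponential K = m ℕ.+ m , (begin-strict
  K ℕ.* suc (m ℕ.+ m)                         <⟨ ℕ.m<m+n _ ℕ.z<s ⟩
  K ℕ.* suc (m ℕ.+ m) ℕ.+ suc (5 ℕ.* K ℕ.+ 3) ≡⟨ square K ⟩
  suc m ℕ.* suc m                             ≤⟨ ℕ.*-mono-≤ (n<2^n m) (n<2^n m) ⟩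
  2 ^ m ℕ.* 2 ^ m                             ≡⟨ ℕ.^-distribˡ-+-* 2 m m ⟨
  2 ^ (m ℕ.+ m)                               ∎)
  where
  open ℕ.≤-Reasoning
  m = 2 ℕ.* K ℕ.+ 1
  square : ∀ K → K ℕ.* suc ((2 ℕ.* K ℕ.+ 1) ℕ.+ (2 ℕ.* K ℕ.+ 1)) ℕ.+ suc (5 ℕ.* K ℕ.+ 3)
               ≡ suc (2 ℕ.* K ℕ.+ 1) ℕ.* suc (2 ℕ.* K ℕ.+ 1)
  square = ℕ-Solver.solve-∀

LinearForm : ℕ → Set
LinearForm n = ℤ × Vec ℤ n

infixl 7 _·_

_·_ : ∀ {n} → Vec ℤ n → Vec ℕ n → ℤ
[]       · []      = 0ℤ
(c ∷ cs) · (a ∷ ρ) = c * + a + cs · ρ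

⟦_⟧ᴸ : ∀ {n} → LinearForm n → Vec ℕ n → ℤ
⟦ k , cs ⟧ᴸ ρ = k + cs · ρ

module _ {n : ℕ} where

  infixl 6 _+ᴸ_ _-ᴸ_
  infixr 7 _*ᴸ_

  _+ᴸ_ : LinearForm n → LinearForm n → LinearForm n
  (k , u) +ᴸ (l , v) = k + l , Vec.zipWith _+_ u v

  _*ᴸ_ : ℤ → LinearForm n → LinearForm n
  z *ᴸ (k , u) = z * k , Vec.map (z *_) u

  negᴸ : LinearForm n → LinearForm n
  negᴸ L = -1ℤ *ᴸ L

  _-ᴸ_ : LinearForm n → LinearForm n → LinearForm n
  L -ᴸ M = L +ᴸ negᴸ M

  constᴸ : ℤ → LinearForm n
  constᴸ z = z , Vec.replicate n 0ℤ

  varᴸ : Fin n → LinearForm n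
  varᴸ i = 0ℤ , Vec.replicate n 0ℤ [ i ]≔ 1ℤ

·-zipWith : ∀ {n} (u v : Vec ℤ n) ρ → Vec.zipWith _+_ u v · ρ ≡ u · ρ + v · ρ
·-zipWith []      []      []      = refl
·-zipWith (c ∷ u) (d ∷ v) (a ∷ ρ) = begin
  (c + d) * + a + Vec.zipWith _+_ u v · ρ ≡⟨ cong (λ s → (c + d) * + a + s) (·-zipWith u v ρ) ⟩
  (c + d) * + a + (u · ρ + v · ρ)         ≡⟨ regroup c d (+ a) (u · ρ) (v · ρ) ⟩
  (c * + a + u · ρ) + (d * + a + v · ρ)   ∎
  where
  open ≡-Reasoning
  regroup : ∀ c d a x y → (c + d) * a + (x + y) ≡ (c * a + x) + (d * a + y)
  regroup = solve-∀

·-map : ∀ {n} z (u : Vec ℤ n) ρ → Vec.map (z *_) u · ρ ≡ z * (u · ρ)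
·-map z []      []      = sym (ℤ.*-zeroʳ z)
·-map z (c ∷ u) (a ∷ ρ) = begin
  z * c * + a + Vec.map (z *_) u · ρ ≡⟨ cong (λ s → z * c * + a + s) (·-map z u ρ) ⟩
  z * c * + a + z * (u · ρ)          ≡⟨ factor z c (+ a) (u · ρ) ⟩
  z * (c * + a + u · ρ)              ∎
  where
  open ≡-Reasoning
  factor : ∀ z c a x → z * c * a + z * x ≡ z * (c * a + x)
  factor = solve-∀

·-zeros : ∀ {n} (ρ : Vec ℕ n) → Vec.replicate n 0ℤ · ρ ≡ 0ℤ
·-zeros []      = refl
·-zeros (a ∷ ρ) = trans (ℤ.+-identityˡ _) (·-zeros ρ)

·-unit : ∀ {n} (i : Fin n) ρ → (Vec.replicate n 0ℤ [ i ]≔ 1ℤ) · ρ ≡ + lookup ρ i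
·-unit zero    (a ∷ ρ) = begin
  1ℤ * + a + Vec.replicate _ 0ℤ · ρ ≡⟨ cong₂ _+_ (ℤ.*-identityˡ (+ a)) (·-zeros ρ) ⟩
  + a + 0ℤ                          ≡⟨ ℤ.+-identityʳ (+ a) ⟩
  + a                               ∎
  where open ≡-Reasoning
·-unit (suc i) (a ∷ ρ) = trans (ℤ.+-identityˡ _) (·-unit i ρ)

module _ {n : ℕ} (ρ : Vec ℕ n) where

  ⟦+ᴸ⟧ : ∀ L M → ⟦ L +ᴸ M ⟧ᴸ ρ ≡ ⟦ L ⟧ᴸ ρ + ⟦ M ⟧ᴸ ρ
  ⟦+ᴸ⟧ (k , u) (l , v) = begin
    k + l + Vec.zipWith _+_ u v · ρ ≡⟨ cong (_+_ (k + l)) (·-zipWith u v ρ) ⟩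
    k + l + (u · ρ + v · ρ)         ≡⟨ regroup k l (u · ρ) (v · ρ) ⟩
    k + u · ρ + (l + v · ρ)         ∎
    where
    open ≡-Reasoning
    regroup : ∀ k l x y → k + l + (x + y) ≡ k + x + (l + y)
    regroup = solve-∀

  ⟦*ᴸ⟧ : ∀ z L → ⟦ z *ᴸ L ⟧ᴸ ρ ≡ z * ⟦ L ⟧ᴸ ρ
  ⟦*ᴸ⟧ z (k , u) = trans (cong (_+_ (z * k)) (·-map z u ρ)) (sym (ℤ.*-distribˡ-+ z k (u · ρ)))

  ⟦negᴸ⟧ : ∀ L → ⟦ negᴸ L ⟧ᴸ ρ ≡ - ⟦ L ⟧ᴸ ρ
  ⟦negᴸ⟧ L = trans (⟦*ᴸ⟧ -1ℤ L) (ℤ.-1*i≡-i (⟦ L ⟧ᴸ ρ))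

  ⟦-ᴸ⟧ : ∀ L M → ⟦ L -ᴸ M ⟧ᴸ ρ ≡ ⟦ L ⟧ᴸ ρ - ⟦ M ⟧ᴸ ρ
  ⟦-ᴸ⟧ L M = trans (⟦+ᴸ⟧ L (negᴸ M)) (cong (_+_ (⟦ L ⟧ᴸ ρ)) (⟦negᴸ⟧ M))

  ⟦constᴸ⟧ : ∀ z → ⟦ constᴸ z ⟧ᴸ ρ ≡ z
  ⟦constᴸ⟧ z = trans (cong (_+_ z) (·-zeros ρ)) (ℤ.+-identityʳ z)

  ⟦varᴸ⟧ : ∀ i → ⟦ varᴸ i ⟧ᴸ ρ ≡ + lookup ρ i
  ⟦varᴸ⟧ i = trans (ℤ.+-identityˡ _) (·-unit i ρ)

⟦∷⟧ᴸ : ∀ {n} k h (cs : Vec ℤ n) a ρ →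
       ⟦ k , h ∷ cs ⟧ᴸ (a ∷ ρ) ≡ h * + a + ⟦ k , cs ⟧ᴸ ρ
⟦∷⟧ᴸ k h cs a ρ = swap k (h * + a) (cs · ρ)
  where
  swap : ∀ k x y → k + (x + y) ≡ x + (k + y)
  swap = solve-∀

⟦∷⟧ᴸ-+ : ∀ {n} k h (cs : Vec ℤ n) D a ρ →
         ⟦ k , h ∷ cs ⟧ᴸ (D ℕ.+ a ∷ ρ) ≡ ⟦ k , h ∷ cs ⟧ᴸ (a ∷ ρ) + h * + D
⟦∷⟧ᴸ-+ k h cs D a ρ = begin
  k + (h * + (D ℕ.+ a) + cs · ρ)    ≡⟨ cong (λ x → k + (h * x + cs · ρ)) (ℤ.pos-+ D a) ⟩
  k + (h * (+ D + + a) + cs · ρ)    ≡⟨ expand k h (+ D) (+ a) (cs · ρ) ⟩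
  k + (h * + a + cs · ρ) + h * + D  ∎
  where
  open ≡-Reasoning
  expand : ∀ k h d a e → k + (h * (d + a) + e) ≡ k + (h * a + e) + h * d
  expand = solve-∀

⟦1+ᴸ⟧ : ∀ {n} (ρ : Vec ℕ n) t → ⟦ constᴸ 1ℤ +ᴸ t ⟧ᴸ ρ ≡ 1ℤ + ⟦ t ⟧ᴸ ρ
⟦1+ᴸ⟧ ρ t = trans (⟦+ᴸ⟧ ρ (constᴸ 1ℤ) t) (cong (_+ ⟦ t ⟧ᴸ ρ) (⟦constᴸ⟧ ρ 1ℤ))

infixr 6 _∧ᶠ_
infixr 5 _∨ᶠ_
infix 7 ¬ᶠ_

data QF (A : Set) : Set where
  ⊥ᶠ        : QF A
  atom      : A → QF A
  ¬ᶠ_       : QF A → QF A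
  _∧ᶠ_ _∨ᶠ_ : QF A → QF A → QF A

module _ {A : Set} where

  Holds : (A → Set) → QF A → Set
  Holds P ⊥ᶠ       = ⊥
  Holds P (atom α) = P α
  Holds P (¬ᶠ ψ)   = ¬ Holds P ψ
  Holds P (ψ ∧ᶠ χ) = Holds P ψ × Holds P χ
  Holds P (ψ ∨ᶠ χ) = Holds P ψ ⊎ Holds P χ

  atoms : QF A → List A
  atoms ⊥ᶠ       = []
  atoms (atom α) = α ∷ []
  atoms (¬ᶠ ψ)   = atoms ψ
  atoms (ψ ∧ᶠ χ) = atoms ψ ++ atoms χ
  atoms (ψ ∨ᶠ χ) = atoms ψ ++ atoms χ

  holds? : ∀ {P} → Decidable P → ∀ ψ → Dec (Holds P ψ)
  holds? P? ⊥ᶠ       = no λ ()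
  holds? P? (atom α) = P? α
  holds? P? (¬ᶠ ψ)   = ¬? (holds? P? ψ)
  holds? P? (ψ ∧ᶠ χ) = holds? P? ψ ×-dec holds? P? χ
  holds? P? (ψ ∨ᶠ χ) = holds? P? ψ ⊎-dec holds? P? χ

  holds-cong : ∀ {P Q} ψ → (∀ {α} → α ∈ atoms ψ → P α ⇔ Q α) → Holds P ψ ⇔ Holds Q ψ
  holds-cong ⊥ᶠ       P⇔Q = ⇔-id ⊥
  holds-cong (atom α) P⇔Q = P⇔Q (here refl)
  holds-cong (¬ᶠ ψ)   P⇔Q = ¬-cong-⇔ (holds-cong ψ P⇔Q)
  holds-cong (ψ ∧ᶠ χ) P⇔Q =
    holds-cong ψ (P⇔Q ∘ ∈-++⁺ˡ) ×-⇔ holds-cong χ (P⇔Q ∘ ∈-++⁺ʳ (atoms ψ))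
  holds-cong (ψ ∨ᶠ χ) P⇔Q =
    holds-cong ψ (P⇔Q ∘ ∈-++⁺ˡ) ⊎-⇔ holds-cong χ (P⇔Q ∘ ∈-++⁺ʳ (atoms ψ))

  ⋁ : {B : Set} → List B → (B → QF A) → QF A
  ⋁ xs f = List.foldr (λ x ψ → f x ∨ᶠ ψ) ⊥ᶠ xs

  holds-⋁ : ∀ {P} {B : Set} (xs : List B) (f : B → QF A) → Holds P (⋁ xs f) ⇔ Any (Holds P ∘ f) xs
  holds-⋁ []       f = mk⇔ (λ ()) (λ ())
  holds-⋁ (x ∷ xs) f = mk⇔ [ here , there ∘ to ih ]
                           (λ { (here p) → inj₁ p ; (there p) → inj₂ (from ih p) })
    where ih = holds-⋁ xs f

mapᶠ : {A B : Set} → (A → B) → QF A → QF B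
mapᶠ f ⊥ᶠ       = ⊥ᶠ
mapᶠ f (atom α) = atom (f α)
mapᶠ f (¬ᶠ ψ)   = ¬ᶠ mapᶠ f ψ
mapᶠ f (ψ ∧ᶠ χ) = mapᶠ f ψ ∧ᶠ mapᶠ f χ
mapᶠ f (ψ ∨ᶠ χ) = mapᶠ f ψ ∨ᶠ mapᶠ f χ

holds-map : {A B : Set} {P : B → Set} (f : A → B) (ψ : QF A) →
            Holds P (mapᶠ f ψ) ⇔ Holds (P ∘ f) ψ
holds-map f ⊥ᶠ       = ⇔-id ⊥
holds-map f (atom α) = ⇔-id _
holds-map f (¬ᶠ ψ)   = ¬-cong-⇔ (holds-map f ψ)
holds-map f (ψ ∧ᶠ χ) = holds-map f ψ ×-⇔ holds-map f χ
holds-map f (ψ ∨ᶠ χ) = holds-map f ψ ⊎-⇔ holds-map f χ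

-- Moduli are written 1 + m so that no atom divides by 0.
data Atom (n : ℕ) : Set where
  0<_     : LinearForm n → Atom n
  [1+_]∣_ : ℕ → LinearForm n → Atom n

⟦_⟧ᴬ : ∀ {n} → Atom n → Vec ℕ n → Set
⟦ 0< L ⟧ᴬ       ρ = 0ℤ < ⟦ L ⟧ᴸ ρ
⟦ [1+ m ]∣ L ⟧ᴬ ρ = + suc m ∣ ⟦ L ⟧ᴸ ρ

⟦_⟧ᴬ? : ∀ {n} (α : Atom n) ρ → Dec (⟦ α ⟧ᴬ ρ)
⟦ 0< L ⟧ᴬ?       ρ = 0ℤ ℤ.<? ⟦ L ⟧ᴸ ρ
⟦ [1+ m ]∣ L ⟧ᴬ? ρ = suc m ℕ.∣? ∣ ⟦ L ⟧ᴸ ρ ∣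

infix 4 _⊨_ _⊨?_

_⊨_ : ∀ {n} → Vec ℕ n → QF (Atom n) → Set
ρ ⊨ ψ = Holds (λ α → ⟦ α ⟧ᴬ ρ) ψ

_⊨?_ : ∀ {n} ρ (ψ : QF (Atom n)) → Dec (ρ ⊨ ψ)
ρ ⊨? ψ = holds? (λ α → ⟦ α ⟧ᴬ? ρ) ψ

modulus : ∀ {n} → Atom n → ℕ
modulus (0< _)       = 1
modulus ([1+ m ]∣ _) = suc m

period : ∀ {n} → QF (Atom n) → ℕ
period ψ = product (List.map modulus (atoms ψ))

modulus∣period : ∀ {n} (ψ : QF (Atom n)) {α} → α ∈ atoms ψ → modulus α ℕ.∣ period ψ
modulus∣period ψ α∈ = ∈⇒∣product (∈-map⁺ modulus α∈)

period-nonZero : ∀ {n} (ψ : QF (Atom n)) → NonZero (period ψ)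
period-nonZero ψ = product≢0 (All.map⁺ (All.universal modulus-nonZero (atoms ψ)))
  where
  modulus-nonZero : ∀ α → NonZero (modulus α)
  modulus-nonZero (0< _)       = _
  modulus-nonZero ([1+ _ ]∣ _) = _

subᴸ : ∀ {n} → ℕ → LinearForm n → LinearForm (suc n) → LinearForm n
subᴸ c t (k , h ∷ cs) = h *ᴸ t +ᴸ + suc c *ᴸ (k , cs)

⟦subᴸ⟧ : ∀ {n} c t (L : LinearForm (suc n)) {ρ a} →
         ⟦ t ⟧ᴸ ρ ≡ + suc c * + a → ⟦ subᴸ c t L ⟧ᴸ ρ ≡ + suc c * ⟦ L ⟧ᴸ (a ∷ ρ)
⟦subᴸ⟧ c t (k , h ∷ cs) {ρ} {a} t≡ = begin
  ⟦ h *ᴸ t +ᴸ c′ *ᴸ (k , cs) ⟧ᴸ ρ       ≡⟨ ⟦+ᴸ⟧ ρ (h *ᴸ t) _ ⟩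
  ⟦ h *ᴸ t ⟧ᴸ ρ + ⟦ c′ *ᴸ (k , cs) ⟧ᴸ ρ ≡⟨ cong₂ _+_ (⟦*ᴸ⟧ ρ h t) (⟦*ᴸ⟧ ρ c′ (k , cs)) ⟩
  h * ⟦ t ⟧ᴸ ρ + c′ * e                 ≡⟨ cong (λ T → h * T + c′ * e) t≡ ⟩
  h * (c′ * + a) + c′ * e               ≡⟨ factor h c′ (+ a) e ⟩
  c′ * (h * + a + e)                    ≡⟨ cong (_*_ c′) (⟦∷⟧ᴸ k h cs a ρ) ⟨
  c′ * ⟦ k , h ∷ cs ⟧ᴸ (a ∷ ρ)          ∎
  where
  open ≡-Reasoning
  c′ = + suc c
  e  = ⟦ k , cs ⟧ᴸ ρ
  factor : ∀ h c a e → h * (c * a) + c * e ≡ c * (h * a + e)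
  factor = solve-∀

-- The modulus m + c (1 + m) is (1 + c)(1 + m) - 1.
subᴬ : ∀ {n} → ℕ → LinearForm n → Atom (suc n) → Atom n
subᴬ c t (0< L)       = 0< subᴸ c t L
subᴬ c t ([1+ m ]∣ L) = [1+ m ℕ.+ c ℕ.* suc m ]∣ subᴸ c t L

subᴬ-correct : ∀ {n} c t (α : Atom (suc n)) {ρ a} →
               ⟦ t ⟧ᴸ ρ ≡ + suc c * + a → ⟦ subᴬ c t α ⟧ᴬ ρ ⇔ ⟦ α ⟧ᴬ (a ∷ ρ)
subᴬ-correct c t (0< L)       {ρ} {a} t≡ rewrite ⟦subᴸ⟧ c t L t≡ =
  0<-*-pos c (⟦ L ⟧ᴸ (a ∷ ρ))
subᴬ-correct c t ([1+ m ]∣ L) {ρ} {a} t≡ rewrite ⟦subᴸ⟧ c t L t≡ =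
  ∣-*-pos c m (⟦ L ⟧ᴸ (a ∷ ρ))

sub : ∀ {n} → ℕ → LinearForm n → QF (Atom (suc n)) → QF (Atom n)
sub c t = mapᶠ (subᴬ c t)

sub-correct : ∀ {n} c t (ψ : QF (Atom (suc n))) {ρ a} →
              ⟦ t ⟧ᴸ ρ ≡ + suc c * + a → ρ ⊨ sub c t ψ ⇔ a ∷ ρ ⊨ ψ
sub-correct c t ψ t≡ =
  holds-cong ψ (λ {α} _ → subᴬ-correct c t α t≡) ⇔-∘ holds-map (subᴬ c t) ψ

instantiate : ∀ {n} → ℕ → QF (Atom (suc n)) → QF (Atom n)
instantiate j = sub 0 (constᴸ (+ j))

instantiate-correct : ∀ {n} j (ψ : QF (Atom (suc n))) {ρ} → ρ ⊨ instantiate j ψ ⇔ j ∷ ρ ⊨ ψ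
instantiate-correct j ψ {ρ} =
  sub-correct 0 _ ψ (trans (⟦constᴸ⟧ ρ (+ j)) (sym (ℤ.*-identityˡ (+ j))))

-- Cooper's elimination of an existential quantifier

-- (p , r) stands for the form (1 + p) a + r in the eliminated variable a; an atom
-- 0 < ±(1 + p) a + r′ can change truth value in a only where this form crosses 0.
Boundary : ℕ → Set
Boundary n = ℕ × LinearForm n

offset : ∀ {n} → Vec ℕ n → ℕ → Boundary n → ℤ
offset ρ a (p , r) = + suc p * + a + ⟦ r ⟧ᴸ ρ

boundary : ∀ {n} → Atom (suc n) → List (Boundary n)
boundary (0< (k , + zero ∷ cs))   = []
boundary (0< (k , + suc p ∷ cs))  = (p , (k , cs)) ∷ []
boundary (0< (k , -[1+ p ] ∷ cs)) = (p , negᴸ (k , cs)) ∷ []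
boundary ([1+ m ]∣ L)             = []

boundaries : ∀ {n} → QF (Atom (suc n)) → List (Boundary n)
boundaries ψ = List.concatMap boundary (atoms ψ)

InWindow : ∀ {n} → Vec ℕ n → ℕ → ℕ → Boundary n → Set
InWindow ρ a D b@(p , _) = 0ℤ ≤ offset ρ a b × offset ρ a b ≤ + (suc p ℕ.* D)

inWindow? : ∀ {n} (ρ : Vec ℕ n) a D → Decidable (InWindow ρ a D)
inWindow? ρ a D b@(p , _) = 0ℤ ℤ.≤? offset ρ a b ×-dec offset ρ a b ℤ.≤? + (suc p ℕ.* D)

offset-+ : ∀ {n} (ρ : Vec ℕ n) D a b →
           offset ρ (D ℕ.+ a) b ≡ offset ρ a b + + (suc (proj₁ b) ℕ.* D)
offset-+ ρ D a (p , r) = begin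
  p′ * + (D ℕ.+ a) + ⟦ r ⟧ᴸ ρ     ≡⟨ cong (λ x → p′ * x + ⟦ r ⟧ᴸ ρ) (ℤ.pos-+ D a) ⟩
  p′ * (+ D + + a) + ⟦ r ⟧ᴸ ρ     ≡⟨ expand p′ (+ D) (+ a) (⟦ r ⟧ᴸ ρ) ⟩
  p′ * + a + ⟦ r ⟧ᴸ ρ + p′ * + D  ≡⟨ cong (_+_ (offset ρ a (p , r))) (ℤ.pos-* (suc p) D) ⟨
  offset ρ a (p , r) + + (suc p ℕ.* D) ∎
  where
  open ≡-Reasoning
  p′ = + suc p
  expand : ∀ c d a e → c * (d + a) + e ≡ c * a + e + c * d
  expand = solve-∀

outside-window : ∀ {n} (ρ : Vec ℕ n) D a b → ¬ InWindow ρ (D ℕ.+ a) D b →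
                 (0ℤ < offset ρ (D ℕ.+ a) b ⇔ 0ℤ < offset ρ a b) ×
                 (offset ρ (D ℕ.+ a) b < 0ℤ ⇔ offset ρ a b < 0ℤ)
outside-window ρ D a b@(p , _) ∉ rewrite offset-+ ρ D a b = sign-stable (offset ρ a b) (suc p ℕ.* D) ∉

⟦-[1+]∷⟧ᴸ : ∀ {n} k p (cs : Vec ℤ n) a ρ →
            ⟦ k , -[1+ p ] ∷ cs ⟧ᴸ (a ∷ ρ) ≡ - offset ρ a (p , negᴸ (k , cs))
⟦-[1+]∷⟧ᴸ k p cs a ρ = begin
  ⟦ k , -[1+ p ] ∷ cs ⟧ᴸ (a ∷ ρ)         ≡⟨ ⟦∷⟧ᴸ k -[1+ p ] cs a ρ ⟩
  - + suc p * + a + ⟦ k , cs ⟧ᴸ ρ        ≡⟨ pull-neg (+ suc p) (+ a) (⟦ k , cs ⟧ᴸ ρ) ⟩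
  - (+ suc p * + a + - ⟦ k , cs ⟧ᴸ ρ)    ≡⟨ cong (λ e → - (+ suc p * + a + e)) (⟦negᴸ⟧ ρ (k , cs)) ⟨
  - offset ρ a (p , negᴸ (k , cs))       ∎
  where
  open ≡-Reasoning
  pull-neg : ∀ c a e → - c * a + e ≡ - (c * a + - e)
  pull-neg = solve-∀

atom-descent : ∀ {n} (α : Atom (suc n)) {ρ a D} → modulus α ℕ.∣ D →
               ¬ Any (InWindow ρ (D ℕ.+ a) D) (boundary α) →
               ⟦ α ⟧ᴬ (D ℕ.+ a ∷ ρ) ⇔ ⟦ α ⟧ᴬ (a ∷ ρ)
atom-descent (0< (k , + zero ∷ cs)) _ _ = ⇔-id _
atom-descent (0< (k , + suc p ∷ cs)) {ρ} {a} {D} _ ∉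
  rewrite ⟦∷⟧ᴸ k (+ suc p) cs (D ℕ.+ a) ρ | ⟦∷⟧ᴸ k (+ suc p) cs a ρ
  = proj₁ (outside-window ρ D a (p , (k , cs)) (∉ ∘ here))
atom-descent (0< (k , -[1+ p ] ∷ cs)) {ρ} {a} {D} _ ∉
  rewrite ⟦-[1+]∷⟧ᴸ k p cs (D ℕ.+ a) ρ | ⟦-[1+]∷⟧ᴸ k p cs a ρ
  = ⇔-sym (0<-⇔<0 _)
    ⇔-∘ (proj₂ (outside-window ρ D a (p , negᴸ (k , cs)) (∉ ∘ here)) ⇔-∘ 0<-⇔<0 _)
atom-descent ([1+ m ]∣ (k , h ∷ cs)) {ρ} {a} {D} m∣D _
  rewrite ⟦∷⟧ᴸ-+ k h cs D a ρ
  = ∣m+n⇔∣m {+ suc m} {⟦ k , h ∷ cs ⟧ᴸ (a ∷ ρ)}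
            (Signed.∣⇒∣ᵤ (Signed.∣n⇒∣m*n h (Signed.∣ᵤ⇒∣ {+ suc m} {+ D} m∣D)))

descent : ∀ {n} (ψ : QF (Atom (suc n))) {ρ a} →
          ¬ Any (InWindow ρ (period ψ ℕ.+ a) (period ψ)) (boundaries ψ) →
          period ψ ℕ.+ a ∷ ρ ⊨ ψ ⇔ a ∷ ρ ⊨ ψ
descent ψ ∉ = holds-cong ψ λ {α} α∈ →
  atom-descent α (modulus∣period ψ α∈)
               (λ inWindow → ∉ (Any.concatMap⁺ boundary (lose α∈ inWindow)))

-- The witness a = t / (1 + p), provided it is a natural number (0 < 1 + t says t ≥ 0).
candidate : ∀ {n} → QF (Atom (suc n)) → ℕ → LinearForm n → QF (Atom n)
candidate ψ p t = atom ([1+ p ]∣ t) ∧ᶠ atom (0< (constᴸ 1ℤ +ᴸ t)) ∧ᶠ sub p t ψ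

nonNegative-multiple : ∀ p {i} → + suc p ∣ i → 0ℤ < 1ℤ + i → ∃ λ q → i ≡ + suc p * + q
nonNegative-multiple p {+ n} (ℕ.divides q n≡q*[1+p]) _ = q , (begin
  + n             ≡⟨ cong +_ n≡q*[1+p] ⟩
  + (q ℕ.* suc p) ≡⟨ cong +_ (ℕ.*-comm q (suc p)) ⟩
  + (suc p ℕ.* q) ≡⟨ ℤ.pos-* (suc p) q ⟩
  + suc p * + q   ∎)
  where open ≡-Reasoning
nonNegative-multiple p { -[1+ zero ] }  _ (ℤ.+<+ ())
nonNegative-multiple p { -[1+ suc n ] } _ ()

candidate-sound : ∀ {n} (ψ : QF (Atom (suc n))) p t {ρ} →
                  ρ ⊨ candidate ψ p t → ∃ λ a → a ∷ ρ ⊨ ψ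
candidate-sound ψ p t {ρ} (p∣t , 0<1+t , sat)
  with a , t≡ ← nonNegative-multiple p p∣t (subst (0ℤ <_) (⟦1+ᴸ⟧ ρ t) 0<1+t)
  = a , to (sub-correct p t ψ t≡) sat

candidate-complete : ∀ {n} (ψ : QF (Atom (suc n))) p t {ρ a} →
                     ⟦ t ⟧ᴸ ρ ≡ + suc p * + a → a ∷ ρ ⊨ ψ → ρ ⊨ candidate ψ p t
candidate-complete ψ p t {ρ} {a} t≡ sat = p∣t , 0<1+t , from (sub-correct p t ψ t≡) sat
  where
  p∣t : + suc p ∣ ⟦ t ⟧ᴸ ρ
  p∣t = subst (λ i → + suc p ∣ i) (sym t≡)
              (Signed.∣⇒∣ᵤ (Signed.∣m⇒∣m*n {+ suc p} (+ a) Signed.∣-refl))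
  0<1+t : 0ℤ < ⟦ constᴸ 1ℤ +ᴸ t ⟧ᴸ ρ
  0<1+t = subst (0ℤ <_) (sym (trans (⟦1+ᴸ⟧ ρ t) (cong (_+_ 1ℤ) t≡′))) (ℤ.+<+ ℕ.z<s)
    where t≡′ = trans t≡ (sym (ℤ.pos-* (suc p) a))

boundaryCandidates : ∀ {n} → QF (Atom (suc n)) → Boundary n → QF (Atom n)
boundaryCandidates ψ (p , r) =
  ⋁ (upTo (suc (suc p ℕ.* period ψ))) (λ j → candidate ψ p (constᴸ (+ j) -ᴸ r))

boundaryCandidates-sound : ∀ {n} (ψ : QF (Atom (suc n))) {ρ} b →
                           ρ ⊨ boundaryCandidates ψ b → ∃ λ a → a ∷ ρ ⊨ ψ
boundaryCandidates-sound ψ (p , r) sat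
  with j , satⱼ ← satisfied (to (holds-⋁ (upTo (suc (suc p ℕ.* period ψ)))
                                          (λ j → candidate ψ p (constᴸ (+ j) -ᴸ r))) sat)
  = candidate-sound ψ p (constᴸ (+ j) -ᴸ r) satⱼ

boundaryCandidates-complete : ∀ {n} (ψ : QF (Atom (suc n))) {ρ a} b →
                              InWindow ρ a (period ψ) b → a ∷ ρ ⊨ ψ → ρ ⊨ boundaryCandidates ψ b
boundaryCandidates-complete ψ {ρ} {a} (p , r) (0≤w , w≤) sat =
  from (holds-⋁ _ _) (Any.applyUpTo⁺ id (candidate-complete ψ p _ t≡ sat) (ℕ.s≤s j≤))
  where
  j = ∣ offset ρ a (p , r) ∣
  +j≡w : + j ≡ offset ρ a (p , r)
  +j≡w = ℤ.0≤i⇒+∣i∣≡i 0≤w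
  j≤ : j ℕ.≤ suc p ℕ.* period ψ
  j≤ = ℤ.drop‿+≤+ (subst (_≤ + (suc p ℕ.* period ψ)) (sym +j≡w) w≤)
  t≡ : ⟦ constᴸ (+ j) -ᴸ r ⟧ᴸ ρ ≡ + suc p * + a
  t≡ = begin
    ⟦ constᴸ (+ j) -ᴸ r ⟧ᴸ ρ            ≡⟨ ⟦-ᴸ⟧ ρ (constᴸ (+ j)) r ⟩
    ⟦ constᴸ (+ j) ⟧ᴸ ρ - ⟦ r ⟧ᴸ ρ      ≡⟨ cong (_- ⟦ r ⟧ᴸ ρ) (trans (⟦constᴸ⟧ ρ (+ j)) +j≡w) ⟩
    + suc p * + a + ⟦ r ⟧ᴸ ρ - ⟦ r ⟧ᴸ ρ ≡⟨ cancel (+ suc p * + a) (⟦ r ⟧ᴸ ρ) ⟩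
    + suc p * + a                       ∎
    where
    open ≡-Reasoning
    cancel : ∀ x e → x + e - e ≡ x
    cancel = solve-∀

elim∃ : ∀ {n} → QF (Atom (suc n)) → QF (Atom n)
elim∃ ψ = ⋁ (upTo (period ψ)) (λ j → instantiate j ψ)
        ∨ᶠ ⋁ (boundaries ψ) (boundaryCandidates ψ)

elim∃-sound : ∀ {n} (ψ : QF (Atom (suc n))) {ρ} → ρ ⊨ elim∃ ψ → ∃ λ a → a ∷ ρ ⊨ ψ
elim∃-sound ψ (inj₁ sat)
  with j , satⱼ ← satisfied (to (holds-⋁ (upTo (period ψ)) (λ j → instantiate j ψ)) sat)
  = j , to (instantiate-correct j ψ) satⱼ
elim∃-sound ψ (inj₂ sat)
  with b , satᵦ ← satisfied (to (holds-⋁ (boundaries ψ) (boundaryCandidates ψ)) sat)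
  = boundaryCandidates-sound ψ b satᵦ

-- If ψ holds at D + a′ and no boundary form lies in its window there, ψ also holds at a′;
-- so the least witness is below D or inside some window.
elim∃-complete : ∀ {n} (ψ : QF (Atom (suc n))) {ρ} a → a ∷ ρ ⊨ ψ → ρ ⊨ elim∃ ψ
elim∃-complete ψ {ρ} a = go a (<-wellFounded a)
  where
  D = period ψ
  0<D : 0 ℕ.< D
  0<D = ℕ.>-nonZero⁻¹ D {{period-nonZero ψ}}
  go : ∀ a → Acc ℕ._<_ a → a ∷ ρ ⊨ ψ → ρ ⊨ elim∃ ψ
  go a (acc smaller) sat with a ℕ.<? D
  ... | yes a<D = inj₁ (from (holds-⋁ _ _)
                         (Any.applyUpTo⁺ id (from (instantiate-correct a ψ) sat) a<D))
  ... | no a≮D with a′ , refl ← ℕ.m≤n⇒∃[o]m+o≡n (ℕ.≮⇒≥ a≮D)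
                   with any? (inWindow? ρ (D ℕ.+ a′) D) (boundaries ψ)
  ...   | yes inWindow = inj₂ (from (holds-⋁ _ _)
                                 (Any.map (λ {b} w → boundaryCandidates-complete ψ b w sat) inWindow))
  ...   | no ∉window   = go a′ (smaller (ℕ.m<n+m a′ 0<D)) (to (descent ψ ∉window) sat)

elim∃-correct : ∀ {n} (ψ : QF (Atom (suc n))) {ρ} → ρ ⊨ elim∃ ψ ⇔ ∃ λ a → a ∷ ρ ⊨ ψ
elim∃-correct ψ = mk⇔ (elim∃-sound ψ) (λ (a , sat) → elim∃-complete ψ a sat)

linearᵀ : ∀ {n} → Term n → LinearForm n
linearᵀ (var i) = varᴸ i
linearᵀ `0      = constᴸ 0ℤ
linearᵀ `1      = constᴸ 1ℤ
linearᵀ (s ⊕ t) = linearᵀ s +ᴸ linearᵀ t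

⟦linearᵀ⟧ : ∀ {n} (t : Term n) ρ → ⟦ linearᵀ t ⟧ᴸ ρ ≡ + evalT t ρ
⟦linearᵀ⟧ (var i) ρ = ⟦varᴸ⟧ ρ i
⟦linearᵀ⟧ `0      ρ = ⟦constᴸ⟧ ρ 0ℤ
⟦linearᵀ⟧ `1      ρ = ⟦constᴸ⟧ ρ 1ℤ
⟦linearᵀ⟧ (s ⊕ t) ρ = begin
  ⟦ linearᵀ s +ᴸ linearᵀ t ⟧ᴸ ρ        ≡⟨ ⟦+ᴸ⟧ ρ (linearᵀ s) (linearᵀ t) ⟩
  ⟦ linearᵀ s ⟧ᴸ ρ + ⟦ linearᵀ t ⟧ᴸ ρ  ≡⟨ cong₂ _+_ (⟦linearᵀ⟧ s ρ) (⟦linearᵀ⟧ t ρ) ⟩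
  + evalT s ρ + + evalT t ρ            ≡⟨ ℤ.pos-+ (evalT s ρ) (evalT t ρ) ⟨
  + (evalT s ρ ℕ.+ evalT t ρ)          ∎
  where open ≡-Reasoning

_<ᶠ_ : ∀ {n} → Term n → Term n → QF (Atom n)
s <ᶠ t = atom (0< (linearᵀ t -ᴸ linearᵀ s))

<ᶠ-correct : ∀ {n} (s t : Term n) ρ → evalT s ρ ℕ.< evalT t ρ ⇔ ρ ⊨ s <ᶠ t
<ᶠ-correct s t ρ rewrite ⟦-ᴸ⟧ ρ (linearᵀ t) (linearᵀ s) | ⟦linearᵀ⟧ t ρ | ⟦linearᵀ⟧ s ρ =
  <⇔0<- (evalT s ρ) (evalT t ρ)

toQF : ∀ {n} → Formula n → QF (Atom n)
toQF (s ≐ t)  = ¬ᶠ (s <ᶠ t) ∧ᶠ ¬ᶠ (t <ᶠ s)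
toQF (s ≺ t)  = s <ᶠ t
toQF (¬' φ)   = ¬ᶠ toQF φ
toQF (φ ∧' ψ) = toQF φ ∧ᶠ toQF ψ
toQF (φ ∨' ψ) = toQF φ ∨ᶠ toQF ψ
toQF (φ ⇒' ψ) = ¬ᶠ toQF φ ∨ᶠ toQF ψ
toQF (∃' φ)   = elim∃ (toQF φ)
toQF (∀' φ)   = ¬ᶠ elim∃ (¬ᶠ toQF φ)

toQF-correct : ∀ {n} (φ : Formula n) ρ → ⟦ φ ⟧ ρ ⇔ ρ ⊨ toQF φ
toQF-correct (s ≐ t)  ρ =
  (¬-cong-⇔ (<ᶠ-correct s t ρ) ×-⇔ ¬-cong-⇔ (<ᶠ-correct t s ρ)) ⇔-∘ ≡⇔≮×≯ _ _
toQF-correct (s ≺ t)  ρ = <ᶠ-correct s t ρ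
toQF-correct (¬' φ)   ρ = ¬-cong-⇔ (toQF-correct φ ρ)
toQF-correct (φ ∧' ψ) ρ = toQF-correct φ ρ ×-⇔ toQF-correct ψ ρ
toQF-correct (φ ∨' ψ) ρ = toQF-correct φ ρ ⊎-⇔ toQF-correct ψ ρ
toQF-correct (φ ⇒' ψ) ρ =
  →⇔¬⊎ (ρ ⊨? toQF φ) ⇔-∘ →-cong-⇔ (toQF-correct φ ρ) (toQF-correct ψ ρ)
toQF-correct (∃' φ)   ρ =
  ⇔-sym (elim∃-correct (toQF φ)) ⇔-∘ ∃-cong-⇔ (λ a → toQF-correct φ (a ∷ ρ))
toQF-correct (∀' φ)   ρ =
  ¬-cong-⇔ (⇔-sym (elim∃-correct (¬ᶠ toQF φ)))
  ⇔-∘ (Π⇔¬∃¬ (λ a → a ∷ ρ ⊨? toQF φ) ⇔-∘ Π-cong-⇔ (λ a → toQF-correct φ (a ∷ ρ)))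

-- Eventual periodicity of definable relations

-- Once C > weight α · (x + 1), an atom 0 < e + a x + b C has the sign of b as its truth value.
weight : Atom 2 → ℕ
weight (0< (e , a ∷ _ ∷ [])) = ∣ a ∣ ℕ.+ ∣ e ∣
weight ([1+ _ ]∣ _)          = 0

weightᶠ : QF (Atom 2) → ℕ
weightᶠ χ = sum (List.map weight (atoms χ))

∣e+a*x∣< : ∀ e a {x C} → (∣ a ∣ ℕ.+ ∣ e ∣) ℕ.* suc x ℕ.< C → ∣ e + a * + x ∣ ℕ.< C
∣e+a*x∣< e a {x} {C} large = begin-strict
  ∣ e + a * + x ∣                                   ≤⟨ ℤ.∣i+j∣≤∣i∣+∣j∣ e (a * + x) ⟩
  ∣ e ∣ ℕ.+ ∣ a * + x ∣                             ≡⟨ cong (ℕ._+_ ∣ e ∣) (ℤ.abs-* a (+ x)) ⟩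
  ∣ e ∣ ℕ.+ ∣ a ∣ ℕ.* x                             ≤⟨ ℕ.m≤m+n _ (∣ a ∣ ℕ.+ ∣ e ∣ ℕ.* x) ⟩
  ∣ e ∣ ℕ.+ ∣ a ∣ ℕ.* x ℕ.+ (∣ a ∣ ℕ.+ ∣ e ∣ ℕ.* x) ≡⟨ expand ∣ a ∣ ∣ e ∣ x ⟩
  (∣ a ∣ ℕ.+ ∣ e ∣) ℕ.* suc x                       <⟨ large ⟩
  C                                                 ∎
  where
  open ℕ.≤-Reasoning
  expand : ∀ a e x → e ℕ.+ a ℕ.* x ℕ.+ (a ℕ.+ e ℕ.* x) ≡ (a ℕ.+ e) ℕ.* suc x
  expand = ℕ-Solver.solve-∀

⟦⟧ᴸ₂ : ∀ e a b {x C} → ⟦ e , a ∷ b ∷ [] ⟧ᴸ (x ∷ C ∷ []) ≡ e + a * + x + b * + C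
⟦⟧ᴸ₂ e a b {x} {C} = drop-0 e a b (+ x) (+ C)
  where
  drop-0 : ∀ e a b x c → e + (a * x + (b * c + 0ℤ)) ≡ e + a * x + b * c
  drop-0 = solve-∀

⟦⟧ᴸ₂-+ : ∀ e a b {x C M} →
         ⟦ e , a ∷ b ∷ [] ⟧ᴸ (x ∷ C ℕ.+ M ∷ []) ≡ ⟦ e , a ∷ b ∷ [] ⟧ᴸ (x ∷ C ∷ []) + b * + M
⟦⟧ᴸ₂-+ e a b {x} {C} {M} rewrite ℤ.pos-+ C M = expand e a b (+ x) (+ C) (+ M)
  where
  expand : ∀ e a b x c m →
           e + (a * x + (b * (c + m) + 0ℤ)) ≡ e + (a * x + (b * c + 0ℤ)) + b * m
  expand = solve-∀

atom-periodic : ∀ α {x C M} → weight α ℕ.* suc x ℕ.< C → modulus α ℕ.∣ M →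
                ⟦ α ⟧ᴬ (x ∷ C ∷ []) ⇔ ⟦ α ⟧ᴬ (x ∷ C ℕ.+ M ∷ [])
atom-periodic (0< (e , a ∷ + zero ∷ [])) _ _ = ⇔-id _
atom-periodic (0< (e , a ∷ + suc q ∷ [])) {x} {C} {M} large _ =
  both (positive large) (positive (ℕ.<-≤-trans large (ℕ.m≤m+n C M)))
  where
  positive : ∀ {C′} → (∣ a ∣ ℕ.+ ∣ e ∣) ℕ.* suc x ℕ.< C′ →
             0ℤ < ⟦ e , a ∷ + suc q ∷ [] ⟧ᴸ (x ∷ C′ ∷ [])
  positive large′ = subst (0ℤ <_) (sym (⟦⟧ᴸ₂ e a (+ suc q)))
                          (∣u∣<C⇒0<u+[1+q]C (e + a * + x) q (∣e+a*x∣< e a large′))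
atom-periodic (0< (e , a ∷ -[1+ q ] ∷ [])) {x} {C} {M} large _ =
  neither (nonPositive large) (nonPositive (ℕ.<-≤-trans large (ℕ.m≤m+n C M)))
  where
  nonPositive : ∀ {C′} → (∣ a ∣ ℕ.+ ∣ e ∣) ℕ.* suc x ℕ.< C′ →
                ¬ 0ℤ < ⟦ e , a ∷ -[1+ q ] ∷ [] ⟧ᴸ (x ∷ C′ ∷ [])
  nonPositive large′ = ∣u∣<C⇒0≮u-[1+q]C (e + a * + x) q (∣e+a*x∣< e a large′)
                     ∘ subst (0ℤ <_) (⟦⟧ᴸ₂ e a -[1+ q ])
atom-periodic ([1+ m ]∣ (e , a ∷ b ∷ [])) {x} {C} {M} _ m∣M
  rewrite ⟦⟧ᴸ₂-+ e a b {x} {C} {M} =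
  ⇔-sym (∣m+n⇔∣m {+ suc m} {⟦ e , a ∷ b ∷ [] ⟧ᴸ (x ∷ C ∷ [])}
                 (Signed.∣⇒∣ᵤ (Signed.∣n⇒∣m*n b (Signed.∣ᵤ⇒∣ {+ suc m} {+ M} m∣M))))

⊨-periodic : ∀ (χ : QF (Atom 2)) {x C} → weightᶠ χ ℕ.* suc x ℕ.< C →
             x ∷ C ∷ [] ⊨ χ ⇔ x ∷ C ℕ.+ period χ ∷ [] ⊨ χ
⊨-periodic χ {x} large = holds-cong χ λ {α} α∈ →
  atom-periodic α (ℕ.≤-<-trans (ℕ.*-monoˡ-≤ (suc x) (∈⇒≤sum (∈-map⁺ weight α∈))) large)
                  (modulus∣period χ α∈)

EventuallyPeriodic : (ℕ → ℕ → Set) → Set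
EventuallyPeriodic R =
  ∃ λ B → ∃ λ M → NonZero M × (∀ x C → B ℕ.* suc x ℕ.< C → R x C ⇔ R x (C ℕ.+ M))

definable⇒eventuallyPeriodic : ∀ {R} → PresburgerDefinable₂ R → EventuallyPeriodic R
definable⇒eventuallyPeriodic {R} (φ , defines) =
  weightᶠ χ , period χ , period-nonZero χ ,
  λ x C large → ⇔-sym (R⇔χ x (C ℕ.+ period χ)) ⇔-∘ (⊨-periodic χ large ⇔-∘ R⇔χ x C)
  where
  χ = toQF φ
  R⇔χ : ∀ x C → R x C ⇔ x ∷ C ∷ [] ⊨ χ
  R⇔χ x C = toQF-correct φ (x ∷ C ∷ []) ⇔-∘ ⇔-sym (defines x C)

divisibility-not-eventuallyPeriodic : ∀ T →
  ¬ EventuallyPeriodic (λ x C → (+ (2 ^ x) - + T) ∣ + C)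
divisibility-not-eventuallyPeriodic T (B , M , M≢0 , periodic) =
  ℕ.<⇒≱ M<d (ℕ.∣⇒≤ {{M≢0}} d∣M)
  where
  K = T ℕ.+ B ℕ.+ M
  x = proj₁ (linear<exponential K)
  d = 2 ^ x ∸ T
  T+[Bx+M]<2^x : T ℕ.+ (B ℕ.* suc x ℕ.+ M) ℕ.< 2 ^ x
  T+[Bx+M]<2^x = begin-strict
    T ℕ.+ (B ℕ.* suc x ℕ.+ M)                      ≤⟨ ℕ.m≤m+n _ ((T ℕ.+ M) ℕ.* x) ⟩
    T ℕ.+ (B ℕ.* suc x ℕ.+ M) ℕ.+ (T ℕ.+ M) ℕ.* x  ≡⟨ expand T B M x ⟩
    K ℕ.* suc x                                    <⟨ proj₂ (linear<exponential K) ⟩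
    2 ^ x                                          ∎
    where
    open ℕ.≤-Reasoning
    expand : ∀ T B M x →
             T ℕ.+ (B ℕ.* suc x ℕ.+ M) ℕ.+ (T ℕ.+ M) ℕ.* x ≡ (T ℕ.+ B ℕ.+ M) ℕ.* suc x
    expand = ℕ-Solver.solve-∀
  Bx+M<d : B ℕ.* suc x ℕ.+ M ℕ.< d
  Bx+M<d = subst (ℕ._< d) (ℕ.m+n∸m≡n T _) (ℕ.∸-monoˡ-< T+[Bx+M]<2^x (ℕ.m≤m+n T _))
  M<d : M ℕ.< d
  M<d = ℕ.≤-<-trans (ℕ.m≤n+m M _) Bx+M<d
  Bx<dM : B ℕ.* suc x ℕ.< d ℕ.* M
  Bx<dM = ℕ.<-≤-trans (ℕ.≤-<-trans (ℕ.m≤m+n _ M) Bx+M<d) (ℕ.m≤m*n d M {{M≢0}})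
  ∣2^x-T∣≡d : ∣ + (2 ^ x) - + T ∣ ≡ d
  ∣2^x-T∣≡d = ∣[+m]-[+n]∣ (ℕ.≤-trans (ℕ.m≤m+n T _) (ℕ.<⇒≤ T+[Bx+M]<2^x))
  d∣dM+M : d ℕ.∣ d ℕ.* M ℕ.+ M
  d∣dM+M = subst (ℕ._∣ d ℕ.* M ℕ.+ M) ∣2^x-T∣≡d
    (to (periodic x (d ℕ.* M) Bx<dM) (subst (ℕ._∣ d ℕ.* M) (sym ∣2^x-T∣≡d) (ℕ.m∣m*n M)))
  d∣M : d ℕ.∣ M
  d∣M = ℕ.∣m+n∣m⇒∣n d∣dM+M (ℕ.m∣m*n M)

corollary7p2 : (y : ℕ) → y ≥ 1 →
    ¬ PresburgerDefinable₂ (λ x C → (+ (2 ^ x) - + (3 ^ y)) ∣ + C)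
corollary7p2 y _ = divisibility-not-eventuallyPeriodic (3 ^ y) ∘ definable⇒eventuallyPeriodic
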